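{- For every safflower $F$ coloured by $k$ colours, $\mathrm{Num}(F) \le 2^k - 1$, where $\mathrm{Num}(F)$ is the number of nicely coloured vertices of $F$.
   Context: A vertex colouring of a graph is a parity vertex colouring ("proper") if every non-empty simple path contains some colour an odd number of times. In a rooted tree a vertex is branched if it has at least two children. A nicely coloured tree is a rooted binary tree (each vertex has at most two children) equipped with a parity vertex colouring such that the root, every branched vertex and every leaf receive one common colour $c$; $c$ is its nice colour and the vertices coloured $c$ are its nicely coloured vertices. Given disjoint nicely coloured trees $T_1,\dots,T_n$ with roots $r_1,\dots,r_n$ (nice colours may differ between trees), add edges $r_ir_{i+1}$ for $1\le i<n$, forming the path $(r_1,\dots,r_n)$ (the stem), and root the resulting tree $G$ at $r_1$. If the induced colouring of $G$ is a parity vertex colouring, $G$ is called a safflower of $T_1,\dots,T_n$ (its original trees). The nicely coloured vertices of the safflower are the nicely coloured vertices of its original trees, and $\mathrm{Num}(G)$ denotes their number. -}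

module Defs where

open import Data.Nat using (ℕ; zero; suc; _+_; _≤_; _%_)
open import Data.Fin using (Fin; _≟_)
open import Data.List using (List; []; _∷_; _++_; [_]; length; lookup; filter; reverse)
open import Data.Product using (Σ; ∃; _×_; _,_)
open import Relation.Binary.PropositionalEquality using (_≡_; _≢_)
open import Relation.Nullary using (¬_; yes; no)

data Tree (k : ℕ) : Set where
  nd : Fin k → List (Tree k) → Tree k

colour : ∀ {k} → Tree k → Fin k
colour (nd c _) = c

children : ∀ {k} → Tree k → List (Tree k)
children (nd _ ts) = ts

occ : ∀ {k} → Fin k → List (Fin k) → ℕ
occ c xs = length (filter (c ≟_) xs)

data Down {k : ℕ} : Tree k → List (Fin k) → Set where
  here  : ∀ {c ts} → Down (nd c ts) (c ∷ [])
  there : ∀ {c ts p} (i : Fin (length ts)) → Down (lookup ts i) p → Down (nd c ts) (c ∷ p)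

-- Non-empty simple paths of the tree (as undirected graph), recorded by the
-- colour sequence of their vertices (each path in one of its orientations).
-- A simple path in a tree has a unique vertex w closest to the root; either the path
-- descends from w along one branch, or it bends at w into two distinct children.
data Path {k : ℕ} : Tree k → List (Fin k) → Set where
  down : ∀ {t p} → Down t p → Path t p
  bend : ∀ {c ts p q} (i j : Fin (length ts)) → i ≢ j →
         Down (lookup ts i) p → Down (lookup ts j) q →
         Path (nd c ts) (reverse p ++ c ∷ q)
  sub  : ∀ {c ts p} (i : Fin (length ts)) → Path (lookup ts i) p → Path (nd c ts) p

IsParity : ∀ {k} → Tree k → Set
IsParity {k} t = ∀ p → Path t p → Σ (Fin k) λ c → occ c p % 2 ≡ 1

-- Subtrees (every vertex, as the subtree rooted at it).
data Sub {k : ℕ} : Tree k → Tree k → Set where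
  self  : ∀ {t} → Sub t t
  below : ∀ {c ts s} (i : Fin (length ts)) → Sub s (lookup ts i) → Sub s (nd c ts)

IsBinary : ∀ {k} → Tree k → Set
IsBinary t = ∀ s → Sub s t → length (children s) ≤ 2

IsNice : ∀ {k} → Fin k → Tree k → Set
IsNice c t = IsBinary t × IsParity t × colour t ≡ c
  × (∀ s → Sub s t → 2 ≤ length (children s) → colour s ≡ c)
  × (∀ s → Sub s t → children s ≡ [] → colour s ≡ c)

record NiceTree (k : ℕ) : Set where
  constructor nice
  field
    tree     : Tree k
    niceCol  : Fin k
    isNice   : IsNice niceCol tree
open NiceTree public

mutual
  countCol : ∀ {k} → Fin k → Tree k → ℕ
  countCol c (nd d ts) with c ≟ d
  ... | yes _ = suc (countColL c ts)
  ... | no  _ = countColL c ts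

  countColL : ∀ {k} → Fin k → List (Tree k) → ℕ
  countColL c [] = 0
  countColL c (t ∷ ts) = countCol c t + countColL c ts

numNice : ∀ {k} → NiceTree k → ℕ
numNice T = countCol (niceCol T) (tree T)

-- Stem construction: add r₁r₂ as an edge, rooted at r₁; here the root of
-- 'attach t u' is the root of t, with u appended as an extra child.
attach : ∀ {k} → Tree k → Tree k → Tree k
attach (nd c ts) u = nd c (ts ++ [ u ])

stemTree : ∀ {k} → NiceTree k → List (NiceTree k) → Tree k
stemTree T [] = tree T
stemTree T (U ∷ Us) = attach (tree T) (stemTree U Us)

IsSafflower : ∀ {k} → NiceTree k → List (NiceTree k) → Set
IsSafflower T Ts = IsParity (stemTree T Ts)

Num : ∀ {k} → NiceTree k → List (NiceTree k) → ℕ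
Num T [] = numNice T
Num T (U ∷ Us) = numNice T + Num U Us

-- Attach to every nicely coloured vertex v of the safflower G its parity
-- vector: the set of colours occurring an odd number of times on the path from the
-- root r₁ to v, an element of Bool^k.  These vectors are nonzero, since the
-- root-to-v path is itself a path of G.  They are pairwise distinct: let u ≠ v be
-- nicely coloured and w their lowest common ancestor.  If w = u, equal vectors would
-- make the path from the child of u down to v even.  Otherwise w is either a branched
-- vertex of an original tree or a stem vertex rᵢ with u in Tᵢ; in both cases w has
-- the colour of u, so the path from v up to w and down to the parent of u has the
-- same parity vector as the walk u ⋯ w ⋯ v, which equal vectors would make even.
-- Counting nonzero Boolean vectors then gives the bound.
module Submission where

open import Defs
open import Data.Nat using (ℕ; zero; suc; _+_; _≤_; _^_; _∸_; _%_; z≤n; s≤s)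
open import Data.Nat.Properties using (+-mono-≤; +-identityʳ; +-suc; module ≤-Reasoning)
open import Data.Bool using (Bool; true; false; not; _xor_)
open import Data.Bool.Properties using (xor-comm; xor-same; not-involutive; not-distribˡ-xor)
open import Data.Fin using (Fin; _≟_; zero; suc)
open import Data.Fin.Properties using (suc-injective)
open import Data.List using (List; []; _∷_; _++_; [_]; length; filter; reverse; map; lookup)
open import Data.List.Properties using (++-assoc; ++-identityʳ; unfold-reverse; length-map; length-++; filter-++)
open import Data.Vec using (Vec; []; _∷_; replicate; tabulate)
open import Data.Vec.Properties using (lookup∘tabulate; lookup-replicate)
open import Data.List.Relation.Unary.All using (All; []; _∷_)
open import Data.List.Relation.Unary.AllPairs using (AllPairs; []; _∷_)
open import Data.List.Relation.Unary.Unique.Propositional using (Unique)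
open import Data.List.Membership.Propositional using (_∈_)
open import Data.List.Membership.Propositional.Properties using (∈-++⁻)
open import Data.List.Relation.Unary.Any using (here; there)
open import Data.Product using (Σ; _×_; _,_)
open import Data.Sum using (inj₁; inj₂)
open import Data.Empty using (⊥-elim)
open import Relation.Binary.PropositionalEquality using (_≡_; _≢_; refl; sym; trans; cong; cong₂; subst; module ≡-Reasoning)
open import Relation.Nullary using (¬_; yes; no)
import Data.Vec as Vec
import Data.List.Relation.Unary.All as All
import Data.List.Relation.Unary.All.Properties as All
import Data.List.Relation.Unary.AllPairs as AllPairs
import Data.List.Relation.Unary.AllPairs.Properties as AllPairs

-- 1. Parities of colour occurrences

odd : ℕ → Bool
odd zero    = false
odd (suc n) = not (odd n)

odd-+ : ∀ m n → odd (m + n) ≡ odd m xor odd n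
odd-+ zero    n = refl
odd-+ (suc m) n = trans (cong not (odd-+ m n)) (not-distribˡ-xor (odd m) (odd n))

odd-%2 : ∀ n → n % 2 ≡ 1 → odd n ≡ true
odd-%2 zero          ()
odd-%2 (suc zero)    _ = refl
odd-%2 (suc (suc n)) r = trans (not-involutive (odd n)) (odd-%2 n r)

oddIn : ∀ {k} → Fin k → List (Fin k) → Bool
oddIn c p = odd (occ c p)

occ-++ : ∀ {k} (c : Fin k) xs ys → occ c (xs ++ ys) ≡ occ c xs + occ c ys
occ-++ c xs ys = trans (cong length (filter-++ (c ≟_) xs ys)) (length-++ (filter (c ≟_) xs))

oddIn-++ : ∀ {k} (c : Fin k) xs ys → oddIn c (xs ++ ys) ≡ oddIn c xs xor oddIn c ys
oddIn-++ c xs ys = trans (cong odd (occ-++ c xs ys)) (odd-+ (occ c xs) (occ c ys))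

oddIn-reverse : ∀ {k} (c : Fin k) xs → oddIn c (reverse xs) ≡ oddIn c xs
oddIn-reverse c []       = refl
oddIn-reverse c (x ∷ xs) = begin
  oddIn c (reverse (x ∷ xs))              ≡⟨ cong (oddIn c) (unfold-reverse x xs) ⟩
  oddIn c (reverse xs ++ [ x ])           ≡⟨ oddIn-++ c (reverse xs) [ x ] ⟩
  oddIn c (reverse xs) xor oddIn c [ x ]  ≡⟨ cong (_xor oddIn c [ x ]) (oddIn-reverse c xs) ⟩
  oddIn c xs xor oddIn c [ x ]            ≡⟨ xor-comm (oddIn c xs) (oddIn c [ x ]) ⟩
  oddIn c [ x ] xor oddIn c xs            ≡⟨ oddIn-++ c [ x ] xs ⟨
  oddIn c (x ∷ xs)                        ∎
  where open ≡-Reasoning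

SameParity : ∀ {k} → List (Fin k) → List (Fin k) → Set
SameParity {k} p q = ∀ (c : Fin k) → oddIn c p ≡ oddIn c q

Even : ∀ {k} → List (Fin k) → Set
Even {k} p = ∀ (c : Fin k) → oddIn c p ≡ false

Separated : ∀ {k} → List (Fin k) → List (Fin k) → Set
Separated p q = ¬ SameParity p q

xor-cancelˡ : ∀ a x y → a xor x ≡ a xor y → x ≡ y
xor-cancelˡ false x y e = e
xor-cancelˡ true  x y e = trans (sym (not-involutive x)) (trans (cong not e) (not-involutive y))

sameParity-cancelˡ : ∀ {k} (a : List (Fin k)) {x y} → SameParity (a ++ x) (a ++ y) → SameParity x y
sameParity-cancelˡ a {x} {y} e c =
  xor-cancelˡ (oddIn c a) _ _ (trans (sym (oddIn-++ c a x)) (trans (e c) (oddIn-++ c a y)))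

sameParity-even : ∀ {k} {x y : List (Fin k)} → SameParity x y → Even (x ++ y)
sameParity-even {x = x} {y} e c =
  trans (oddIn-++ c x y) (trans (cong (_xor oddIn c y) (e c)) (xor-same (oddIn c y)))

sameParity-reverse : ∀ {k} (q : List (Fin k)) d → SameParity (reverse q ++ [ d ]) (q ++ [ d ])
sameParity-reverse q d c = begin
  oddIn c (reverse q ++ [ d ])           ≡⟨ oddIn-++ c (reverse q) [ d ] ⟩
  oddIn c (reverse q) xor oddIn c [ d ]  ≡⟨ cong (_xor oddIn c [ d ]) (oddIn-reverse c q) ⟩
  oddIn c q xor oddIn c [ d ]            ≡⟨ oddIn-++ c q [ d ] ⟨
  oddIn c (q ++ [ d ])                   ∎
  where open ≡-Reasoning

path-not-even : ∀ {k} {t : Tree k} {p} → IsParity t → Path t p → ¬ Even p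
path-not-even {p = p} par path ev with par p path
... | c , odd-c = ⊥-elim (true≢false (trans (sym (odd-%2 (occ c p) odd-c)) (ev c)))
  where
  true≢false : ¬ true ≡ false
  true≢false ()

-- 2. Counting distinct nonzero Boolean vectors

withTrue withFalse : ∀ {k} → List (Vec Bool (suc k)) → List (Vec Bool k)
withTrue []                  = []
withTrue ((true  ∷ v) ∷ L)   = v ∷ withTrue L
withTrue ((false ∷ v) ∷ L)   = withTrue L
withFalse []                 = []
withFalse ((true  ∷ v) ∷ L)  = withFalse L
withFalse ((false ∷ v) ∷ L)  = v ∷ withFalse L

length-split : ∀ {k} (L : List (Vec Bool (suc k))) → length L ≡ length (withTrue L) + length (withFalse L)
length-split []                = refl
length-split ((true  ∷ v) ∷ L) = cong suc (length-split L)
length-split ((false ∷ v) ∷ L) = trans (cong suc (length-split L)) (sym (+-suc _ _))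

withTrue-avoids : ∀ {k} (v : Vec Bool k) L → All (true ∷ v ≢_) L → All (v ≢_) (withTrue L)
withTrue-avoids v []                [] = []
withTrue-avoids v ((true  ∷ w) ∷ L) (p ∷ ps) = (λ e → p (cong (true ∷_) e)) ∷ withTrue-avoids v L ps
withTrue-avoids v ((false ∷ w) ∷ L) (p ∷ ps) = withTrue-avoids v L ps

withFalse-avoids : ∀ {k} (v : Vec Bool k) L → All (false ∷ v ≢_) L → All (v ≢_) (withFalse L)
withFalse-avoids v []                [] = []
withFalse-avoids v ((true  ∷ w) ∷ L) (p ∷ ps) = withFalse-avoids v L ps
withFalse-avoids v ((false ∷ w) ∷ L) (p ∷ ps) = (λ e → p (cong (false ∷_) e)) ∷ withFalse-avoids v L ps

withTrue-unique : ∀ {k} (L : List (Vec Bool (suc k))) → Unique L → Unique (withTrue L)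
withTrue-unique []                []       = []
withTrue-unique ((true  ∷ v) ∷ L) (p ∷ ps) = withTrue-avoids v L p ∷ withTrue-unique L ps
withTrue-unique ((false ∷ v) ∷ L) (p ∷ ps) = withTrue-unique L ps

withFalse-unique : ∀ {k} (L : List (Vec Bool (suc k))) → Unique L → Unique (withFalse L)
withFalse-unique []                []       = []
withFalse-unique ((true  ∷ v) ∷ L) (p ∷ ps) = withFalse-unique L ps
withFalse-unique ((false ∷ v) ∷ L) (p ∷ ps) = withFalse-avoids v L p ∷ withFalse-unique L ps

unique-vectors-bound : ∀ k (L : List (Vec Bool k)) → Unique L → length L ≤ 2 ^ k
unique-vectors-bound zero    []               _               = z≤n
unique-vectors-bound zero    ([] ∷ [])        _               = s≤s z≤n
unique-vectors-bound zero    ([] ∷ [] ∷ L)    ((p ∷ _) ∷ _)   = ⊥-elim (p refl)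
unique-vectors-bound (suc k) L u = begin
  length L                                     ≡⟨ length-split L ⟩
  length (withTrue L) + length (withFalse L)   ≤⟨ +-mono-≤ (unique-vectors-bound k (withTrue L) (withTrue-unique L u))
                                                           (unique-vectors-bound k (withFalse L) (withFalse-unique L u)) ⟩
  2 ^ k + 2 ^ k                                ≡⟨ cong (2 ^ k +_) (+-identityʳ (2 ^ k)) ⟨
  2 ^ suc k                                    ∎
  where open ≤-Reasoning

nonzero-unique-vectors-bound : ∀ k (L : List (Vec Bool k)) → Unique L →
                               All (replicate k false ≢_) L → length L ≤ 2 ^ k ∸ 1
nonzero-unique-vectors-bound k L u z = pred-≤ (unique-vectors-bound k (replicate k false ∷ L) (z ∷ u))
  where
  pred-≤ : ∀ {n m} → suc n ≤ m → n ≤ m ∸ 1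
  pred-≤ (s≤s p) = p

-- 3. Vertices reached from the root

-- Reach t q x: t has a vertex of colour x whose proper ancestors, listed from the
-- root downwards, have colours q.  So q ++ [ x ] is the colour sequence of the
-- root-to-vertex path.
data Reach {k : ℕ} : Tree k → List (Fin k) → Fin k → Set where
  root : ∀ {c ts} → Reach (nd c ts) [] c
  step : ∀ {c ts q x} (i : Fin (length ts)) → Reach (lookup ts i) q x → Reach (nd c ts) (c ∷ q) x

reach-down : ∀ {k} {t : Tree k} {q x} → Reach t q x → Down t (q ++ [ x ])
reach-down root       = here
reach-down (step i w) = there i (reach-down w)

reach-down-parent : ∀ {k} {t : Tree k} {a q x} → Reach t (a ∷ q) x → Down t (a ∷ q)
reach-down-parent (step {q = []}    i w) = here
reach-down-parent (step {q = _ ∷ _} i w) = there i (reach-down-parent w)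

reach-not-even : ∀ {k} {t : Tree k} {q x} → IsParity t → Reach t q x → ¬ Even (q ++ [ x ])
reach-not-even par w = path-not-even par (down (reach-down w))

-- A vertex and any proper descendant are separated (under any common prefix a):
-- otherwise the path from the child of the vertex down to the descendant is even.
below-separated : ∀ {k} {s : Tree k} {q y} → IsParity s → Reach s q y →
                  ∀ a → Separated a (a ++ q ++ [ y ])
below-separated {q = q} {y} par w a e = reach-not-even par w (λ c → sym (sameParity-cancelˡ a e′ c))
  where
  e′ : SameParity (a ++ []) (a ++ q ++ [ y ])
  e′ c = trans (cong (oddIn _) (++-identityʳ a)) (e c)

-- The path from the parent of a vertex in child i up to the root d and down to
-- a vertex in a different child j (just d ∷ … when the first vertex is child i itself).
bend-path : ∀ {k} {d : Fin k} {ts q q′ x y} (i j : Fin (length ts)) → i ≢ j →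
            Reach (lookup ts i) q x → Reach (lookup ts j) q′ y →
            Path (nd d ts) (reverse q ++ d ∷ q′ ++ [ y ])
bend-path {q = []}    i j _  _ w′ = down (there j (reach-down w′))
bend-path {q = _ ∷ _} i j ne w w′ = bend i j ne (reach-down-parent w) (reach-down w′)

-- Let the root have colour d.  A vertex of colour d in child i and any vertex in a
-- different child j are separated: equal parities would make 'bend-path' even.
bend-separated : ∀ {k} {d : Fin k} {ts q q′ y} → IsParity (nd d ts) → (i j : Fin (length ts)) → i ≢ j →
                 Reach (lookup ts i) q d → Reach (lookup ts j) q′ y →
                 ∀ a → Separated (a ++ q ++ [ d ]) (a ++ q′ ++ [ y ])
bend-separated {d = d} {q = q} {q′} {y} par i j ne w w′ a e =
  path-not-even par (bend-path i j ne w w′) even-bend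
  where
  even-bend : Even (reverse q ++ d ∷ q′ ++ [ y ])
  even-bend c = trans (cong (oddIn c) (sym (++-assoc (reverse q) [ d ] (q′ ++ [ y ]))))
    (sameParity-even {x = reverse q ++ [ d ]} {y = q′ ++ [ y ]}
      (λ c′ → trans (sameParity-reverse q d c′) (sameParity-cancelˡ a {q ++ [ d ]} e c′)) c)

-- 4a. Ancestries of the vertices of a given colour in a tree

mutual
  -- ancestries pre c t lists pre ++ (colours of the root-to-v path) for each vertex v
  -- of t of colour c; the prefix pre records the path above t in a larger tree.
  ancestries : ∀ {k} → List (Fin k) → Fin k → Tree k → List (List (Fin k))
  ancestries pre c (nd d ts) with c ≟ d
  ... | yes _ = (pre ++ [ d ]) ∷ ancestriesᶠ (pre ++ [ d ]) c ts
  ... | no  _ = ancestriesᶠ (pre ++ [ d ]) c ts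

  ancestriesᶠ : ∀ {k} → List (Fin k) → Fin k → List (Tree k) → List (List (Fin k))
  ancestriesᶠ pre c []       = []
  ancestriesᶠ pre c (t ∷ ts) = ancestries pre c t ++ ancestriesᶠ pre c ts

mutual
  length-ancestries : ∀ {k} pre (c : Fin k) t → length (ancestries pre c t) ≡ countCol c t
  length-ancestries pre c (nd d ts) with c ≟ d
  ... | yes _ = cong suc (length-ancestriesᶠ (pre ++ [ d ]) c ts)
  ... | no  _ = length-ancestriesᶠ (pre ++ [ d ]) c ts

  length-ancestriesᶠ : ∀ {k} pre (c : Fin k) ts → length (ancestriesᶠ pre c ts) ≡ countColL c ts
  length-ancestriesᶠ pre c []       = refl
  length-ancestriesᶠ pre c (t ∷ ts) =
    trans (length-++ (ancestries pre c t)) (cong₂ _+_ (length-ancestries pre c t) (length-ancestriesᶠ pre c ts))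

mutual
  ancestries-reach : ∀ {k} pre (c : Fin k) t {p} → p ∈ ancestries pre c t →
                     Σ (List (Fin k)) λ q → Reach t q c × p ≡ pre ++ q ++ [ c ]
  ancestries-reach pre c (nd d ts) m with c ≟ d
  ancestries-reach pre c (nd d ts) (here eq) | yes refl = [] , root , eq
  ancestries-reach pre c (nd d ts) (there m) | yes refl = ancestries-child-reach pre c d ts m
  ancestries-reach pre c (nd d ts) m         | no  _    = ancestries-child-reach pre c d ts m

  ancestriesᶠ-reach : ∀ {k} pre (c : Fin k) ts {p} → p ∈ ancestriesᶠ pre c ts →
                      Σ (Fin (length ts)) λ i → Σ (List (Fin k)) λ q → Reach (lookup ts i) q c × p ≡ pre ++ q ++ [ c ]
  ancestriesᶠ-reach pre c (t ∷ ts) m with ∈-++⁻ (ancestries pre c t) m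
  ... | inj₁ m₁ with ancestries-reach pre c t m₁
  ...   | q , w , eq = zero , q , w , eq
  ancestriesᶠ-reach pre c (t ∷ ts) m | inj₂ m₂ with ancestriesᶠ-reach pre c ts m₂
  ...   | i , q , w , eq = suc i , q , w , eq

  ancestries-child-reach : ∀ {k} pre (c d : Fin k) ts {p} → p ∈ ancestriesᶠ (pre ++ [ d ]) c ts →
          Σ (List (Fin k)) λ q → Reach (nd d ts) q c × p ≡ pre ++ q ++ [ c ]
  ancestries-child-reach pre c d ts m with ancestriesᶠ-reach (pre ++ [ d ]) c ts m
  ... | i , q , w , eq = d ∷ q , step i w , trans eq (++-assoc pre [ d ] (q ++ [ c ]))

BranchedColoured : ∀ {k} → Fin k → Tree k → Set
BranchedColoured c t = ∀ s → Sub s t → 2 ≤ length (children s) → colour s ≡ c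

Apart : ∀ {k} → Fin k → Tree k → Tree k → Set
Apart {k} c s s′ = ∀ {q q′} → Reach s q c → Reach s′ q′ c → ∀ (a : List (Fin k)) → Separated (a ++ q ++ [ c ]) (a ++ q′ ++ [ c ])

child-parity : ∀ {k} {d : Fin k} {ts} → IsParity (nd d ts) → ∀ i → IsParity (lookup ts i)
child-parity par i p path = par p (sub i path)

child-branched : ∀ {k} {c d : Fin k} {ts} → BranchedColoured c (nd d ts) → ∀ i → BranchedColoured c (lookup ts i)
child-branched br i s sb = br s (below i sb)

two≤ : ∀ {n} (i j : Fin n) → i ≢ j → 2 ≤ n
two≤ {suc zero}    zero zero ne = ⊥-elim (ne refl)
two≤ {suc (suc n)} _    _    _  = s≤s (s≤s z≤n)

-- Distinct children are apart: the root is then branched, hence of colour c.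
children-apart : ∀ {k} {c d : Fin k} {ts} → IsParity (nd d ts) → BranchedColoured c (nd d ts) →
                 ∀ i j → i ≢ j → Apart c (lookup ts i) (lookup ts j)
children-apart {ts = ts} par br i j ne w w′ a with br (nd _ ts) self (two≤ i j ne)
... | refl = bend-separated par i j ne w w′ a

mutual
  ancestries-separated : ∀ {k} pre (c : Fin k) t → IsParity t → BranchedColoured c t →
                         AllPairs Separated (ancestries pre c t)
  ancestries-separated pre c (nd d ts) par br with c ≟ d
  ... | yes refl = All.tabulate root-above ∷ children-separated pre c d ts par br
    where
    root-above : ∀ {x} → x ∈ ancestriesᶠ (pre ++ [ d ]) c ts → Separated (pre ++ [ d ]) x
    root-above m with ancestriesᶠ-reach (pre ++ [ d ]) c ts m
    ... | i , q , w , refl = below-separated (child-parity par i) w (pre ++ [ d ])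
  ... | no _ = children-separated pre c d ts par br

  children-separated : ∀ {k} pre (c d : Fin k) ts → IsParity (nd d ts) → BranchedColoured c (nd d ts) →
                       AllPairs Separated (ancestriesᶠ (pre ++ [ d ]) c ts)
  children-separated pre c d ts par br =
    ancestriesᶠ-separated (pre ++ [ d ]) c ts (child-parity par) (child-branched br) (children-apart par br)

  ancestriesᶠ-separated : ∀ {k} pre (c : Fin k) ts →
    (∀ i → IsParity (lookup ts i)) → (∀ i → BranchedColoured c (lookup ts i)) →
    (∀ i j → i ≢ j → Apart c (lookup ts i) (lookup ts j)) →
    AllPairs Separated (ancestriesᶠ pre c ts)
  ancestriesᶠ-separated pre c []       _  _  _  = []
  ancestriesᶠ-separated pre c (t ∷ ts) hp hb ha =
    AllPairs.++⁺ (ancestries-separated pre c t (hp zero) (hb zero))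
      (ancestriesᶠ-separated pre c ts (λ i → hp (suc i)) (λ i → hb (suc i))
                                     (λ i j ne → ha (suc i) (suc j) (λ e → ne (suc-injective e))))
      (All.tabulate λ m → All.tabulate λ m′ → first-vs-rest m m′)
    where
    first-vs-rest : ∀ {x y} → x ∈ ancestries pre c t → y ∈ ancestriesᶠ pre c ts → Separated x y
    first-vs-rest m m′ with ancestries-reach pre c t m | ancestriesᶠ-reach pre c ts m′
    ... | q , w , refl | j , q′ , w′ , refl = ha zero (suc j) (λ ()) w w′ pre

-- 4b. Attaching a tree as a last child

module _ {A : Set} where
  initIndex : (xs : List A) (y : A) → Fin (length xs) → Fin (length (xs ++ [ y ]))
  initIndex (x ∷ xs) y zero    = zero
  initIndex (x ∷ xs) y (suc i) = suc (initIndex xs y i)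

  lastIndex : (xs : List A) (y : A) → Fin (length (xs ++ [ y ]))
  lastIndex []       y = zero
  lastIndex (x ∷ xs) y = suc (lastIndex xs y)

  lookup-initIndex : (xs : List A) (y : A) (i : Fin (length xs)) → lookup (xs ++ [ y ]) (initIndex xs y i) ≡ lookup xs i
  lookup-initIndex (x ∷ xs) y zero    = refl
  lookup-initIndex (x ∷ xs) y (suc i) = lookup-initIndex xs y i

  lookup-lastIndex : (xs : List A) (y : A) → lookup (xs ++ [ y ]) (lastIndex xs y) ≡ y
  lookup-lastIndex []       y = refl
  lookup-lastIndex (x ∷ xs) y = lookup-lastIndex xs y

  initIndex≢lastIndex : (xs : List A) (y : A) (i : Fin (length xs)) → initIndex xs y i ≢ lastIndex xs y
  initIndex≢lastIndex (x ∷ xs) y zero    ()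
  initIndex≢lastIndex (x ∷ xs) y (suc i) e = initIndex≢lastIndex xs y i (suc-injective e)

reach-attachˡ : ∀ {k} {t u : Tree k} {q x} → Reach t q x → Reach (attach t u) q x
reach-attachˡ root = root
reach-attachˡ {t = nd d ts} {u} (step i w) =
  step (initIndex ts u i) (subst (λ s → Reach s _ _) (sym (lookup-initIndex ts u i)) w)

reach-attachʳ : ∀ {k} {t u : Tree k} {q x} → Reach u q x → Reach (attach t u) (colour t ∷ q) x
reach-attachʳ {t = nd d ts} {u} w = step (lastIndex ts u) (subst (λ s → Reach s _ _) (sym (lookup-lastIndex ts u)) w)

parity-attachʳ : ∀ {k} {t u : Tree k} → IsParity (attach t u) → IsParity u
parity-attachʳ {t = nd d ts} {u} par p path =
  par p (sub (lastIndex ts u) (subst (λ s → Path s p) (sym (lookup-lastIndex ts u)) path))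

-- In attach t u, a vertex of t of the root colour c and any vertex of u are
-- separated: the root of t is their lowest common ancestor.
attach-separated : ∀ {k} {t u : Tree k} {c q q′ y} → IsParity (attach t u) → colour t ≡ c →
                   Reach t q c → Reach u q′ y → ∀ pre →
                   Separated (pre ++ q ++ [ c ]) ((pre ++ [ colour t ]) ++ q′ ++ [ y ])
attach-separated {t = nd d ts} par refl root w′ pre = below-separated (parity-attachʳ par) w′ (pre ++ [ d ])
attach-separated {t = nd d ts} {u} {q = d ∷ q} {q′} {y} par refl (step i w) w′ pre =
  subst (λ z → Separated z ((pre ++ [ d ]) ++ q′ ++ [ y ])) (++-assoc pre [ d ] (q ++ [ d ]))
    (bend-separated par (initIndex ts u i) (lastIndex ts u) (initIndex≢lastIndex ts u i)
      (subst (λ s → Reach s _ _) (sym (lookup-initIndex ts u i)) w)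
      (subst (λ s → Reach s _ _) (sym (lookup-lastIndex ts u)) w′)
      (pre ++ [ d ]))

-- 4c. Ancestries of the nicely coloured vertices of a safflower

stemAncestries : ∀ {k} → List (Fin k) → NiceTree k → List (NiceTree k) → List (List (Fin k))
stemAncestries pre T []       = ancestries pre (niceCol T) (tree T)
stemAncestries pre T (U ∷ Us) = ancestries pre (niceCol T) (tree T) ++ stemAncestries (pre ++ [ colour (tree T) ]) U Us

length-stemAncestries : ∀ {k} pre (T : NiceTree k) Us → length (stemAncestries pre T Us) ≡ Num T Us
length-stemAncestries pre T []       = length-ancestries pre (niceCol T) (tree T)
length-stemAncestries pre T (U ∷ Us) =
  trans (length-++ (ancestries pre (niceCol T) (tree T)))
        (cong₂ _+_ (length-ancestries pre (niceCol T) (tree T)) (length-stemAncestries _ U Us))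

stemAncestries-reach : ∀ {k} pre (T : NiceTree k) Us {p} → p ∈ stemAncestries pre T Us →
  Σ (List (Fin k)) λ q → Σ (Fin k) λ x → Reach (stemTree T Us) q x × p ≡ pre ++ q ++ [ x ]
stemAncestries-reach pre T [] m with ancestries-reach pre (niceCol T) (tree T) m
... | q , w , eq = q , niceCol T , w , eq
stemAncestries-reach pre T (U ∷ Us) m with ∈-++⁻ (ancestries pre (niceCol T) (tree T)) m
... | inj₁ m₁ with ancestries-reach pre (niceCol T) (tree T) m₁
...   | q , w , eq = q , niceCol T , reach-attachˡ w , eq
stemAncestries-reach pre T (U ∷ Us) m | inj₂ m₂ with stemAncestries-reach (pre ++ [ colour (tree T) ]) U Us m₂
...   | q , x , w , eq = colour (tree T) ∷ q , x , reach-attachʳ w ,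
                         trans eq (++-assoc pre [ colour (tree T) ] (q ++ [ x ]))

stemAncestries-separated : ∀ {k} pre (T : NiceTree k) Us → IsSafflower T Us →
                           AllPairs Separated (stemAncestries pre T Us)
stemAncestries-separated pre (nice t c (_ , par , _ , br , _)) [] _ = ancestries-separated pre c t par br
stemAncestries-separated pre (nice t c (_ , par , col , br , _)) (U ∷ Us) saf =
  AllPairs.++⁺ (ancestries-separated pre c t par br)
    (stemAncestries-separated (pre ++ [ colour t ]) U Us (parity-attachʳ saf))
    (All.tabulate λ m → All.tabulate λ m′ → first-vs-rest m m′)
  where
  first-vs-rest : ∀ {x y} → x ∈ ancestries pre c t → y ∈ stemAncestries (pre ++ [ colour t ]) U Us → Separated x y
  first-vs-rest m m′ with ancestries-reach pre c t m | stemAncestries-reach (pre ++ [ colour t ]) U Us m′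
  ... | q , w , refl | q′ , y , w′ , refl = attach-separated saf col w w′ pre

parityVector : ∀ {k} → List (Fin k) → Vec Bool k
parityVector p = tabulate (λ c → oddIn c p)

parityVector-sameParity : ∀ {k} {p q : List (Fin k)} → parityVector p ≡ parityVector q → SameParity p q
parityVector-sameParity {p = p} {q} eq c =
  trans (sym (lookup∘tabulate (λ c′ → oddIn c′ p) c))
        (trans (cong (λ v → Vec.lookup v c) eq) (lookup∘tabulate (λ c′ → oddIn c′ q) c))

parityVector-even : ∀ {k} {p : List (Fin k)} → replicate k false ≡ parityVector p → Even p
parityVector-even {p = p} eq c =
  trans (sym (lookup∘tabulate (λ c′ → oddIn c′ p) c))
        (trans (cong (λ v → Vec.lookup v c) (sym eq)) (lookup-replicate c false))

lemma7 : (k : ℕ) (T₁ : NiceTree k) (Ts : List (NiceTree k)) →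
         IsSafflower T₁ Ts → Num T₁ Ts ≤ 2 ^ k ∸ 1
lemma7 k T₁ Ts saf = begin
  Num T₁ Ts                    ≡⟨ length-stemAncestries [] T₁ Ts ⟨
  length L                     ≡⟨ length-map parityVector L ⟨
  length (map parityVector L)  ≤⟨ nonzero-unique-vectors-bound k (map parityVector L) distinct nonzero ⟩
  2 ^ k ∸ 1                    ∎
  where
  open ≤-Reasoning
  L : List (List (Fin k))
  L = stemAncestries [] T₁ Ts
  distinct : Unique (map parityVector L)
  distinct = AllPairs.map⁺ (AllPairs.map (λ {p} {q} sep eq → sep (parityVector-sameParity {p = p} {q} eq))
                                         (stemAncestries-separated [] T₁ Ts saf))
  nonzero : All (replicate k false ≢_) (map parityVector L)
  nonzero = All.map⁺ (All.tabulate λ m → root-path-odd m)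
    where
    root-path-odd : ∀ {p} → p ∈ L → replicate k false ≢ parityVector p
    root-path-odd m eq with stemAncestries-reach [] T₁ Ts m
    ... | q , x , w , refl = reach-not-even saf w (parityVector-even {p = q ++ [ x ]} eq)
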